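{- Let $G$ be an infinite computable graph that is locally finite, and let $C\subseteq\omega$ be a cohesive set. Then there is a computable, strongly locally finite graph $\mathcal{A}$ such that the cohesive power $\prod_C\mathcal{A}$ is isomorphic to the disjoint union $G\sqcup H$ for some graph $H$.
   Context: A graph is a structure $(V,E)$ with $V\neq\emptyset$ and $E$ a symmetric binary relation; it is computable if $V\subseteq\omega$ and $E$ are computable. It is locally finite if every vertex is adjacent to finitely many vertices, and strongly locally finite if all its connected components are finite. The disjoint union $(V_1,E_1)\sqcup(V_2,E_2)$ of graphs with $V_1\cap V_2=\emptyset$ is $(V_1\cup V_2,E_1\cup E_2)$. A set $C\subseteq\omega$ is cohesive if it is infinite and for every c.e. set $W$, one of $W\cap C$, $\overline{W}\cap C$ is finite; $X\subseteq^*Y$ means $X\setminus Y$ is finite. For a computable structure $\mathcal{A}$ with domain $A$ and cohesive $C$, the cohesive power $\prod_C\mathcal{A}$ has as domain the partial computable functions $\psi:\omega\to A$ with $C\subseteq^*\mathrm{dom}(\psi)$, modulo $\psi_1=_C\psi_2$ iff $C\subseteq^*\{i:\psi_1(i)\downarrow=\psi_2(i)\downarrow\}$; a relation $R$ holds of $([\psi_1],\dots,[\psi_m])$ iff $C\subseteq^*\{i:R^{\mathcal{A}}(\psi_1(i),\dots,\psi_m(i))\}$. -}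

module Defs where

open import Data.Nat using (ℕ; zero; suc; _<_)
open import Data.Fin using (Fin)
open import Data.Vec using (Vec; []; _∷_; lookup)
open import Data.Maybe using (Maybe; just; nothing; _>>=_)
import Data.Maybe as Maybe
open import Data.Product using (Σ; ∃; ∃₂; _×_; _,_; proj₁)
open import Data.Sum using (_⊎_; inj₁; inj₂)
open import Data.Empty using (⊥)
open import Relation.Nullary using (¬_)
open import Relation.Binary.PropositionalEquality using (_≡_)
open import Relation.Binary.Construct.Closure.ReflexiveTransitive using (Star)

data PR : ℕ → Set where
  zeroF : ∀ {n} → PR n
  succF : PR 1
  projF : ∀ {n} → Fin n → PR n
  compF : ∀ {m n} → PR m → Vec (PR n) m → PR n
  primF : ∀ {n} → PR n → PR (suc (suc n)) → PR (suc n)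
  muF   : ∀ {n} → PR (suc n) → PR n

-- fuel-bounded evaluation
mutual
  eval : ∀ {n} → ℕ → PR n → Vec ℕ n → Maybe ℕ
  eval zero    _           _              = nothing
  eval (suc k) zeroF       _              = just 0
  eval (suc k) succF       (x ∷ [])       = just (suc x)
  eval (suc k) (projF i)   xs             = just (lookup xs i)
  eval (suc k) (compF f gs) xs            = evalV k gs xs >>= eval k f
  eval (suc k) (primF f g) (zero ∷ xs)    = eval k f xs
  eval (suc k) (primF f g) (suc x ∷ xs)   =
    eval k (primF f g) (x ∷ xs) >>= λ r → eval k g (x ∷ r ∷ xs)
  eval (suc k) (muF f)     xs             = search k f xs 0

  evalV : ∀ {m n} → ℕ → Vec (PR n) m → Vec ℕ n → Maybe (Vec ℕ m)
  evalV k []       xs = just []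
  evalV k (g ∷ gs) xs = eval k g xs >>= λ r → Maybe.map (r ∷_) (evalV k gs xs)

  search : ∀ {n} → ℕ → PR (suc n) → Vec ℕ n → ℕ → Maybe ℕ
  search zero    f xs y = nothing
  search (suc k) f xs y = eval k f (y ∷ xs) >>= λ
    { zero    → just y
    ; (suc _) → search k f xs (suc y) }

_⟨_⟩↓_ : ∀ {n} → PR n → Vec ℕ n → ℕ → Set
e ⟨ xs ⟩↓ y = ∃ λ s → eval s e xs ≡ just y

_⟪_⟫↓_ : PR 1 → ℕ → ℕ → Set
ψ ⟪ i ⟫↓ y = ψ ⟨ i ∷ [] ⟩↓ y

Dom : PR 1 → ℕ → Set
Dom ψ i = ∃ λ y → ψ ⟪ i ⟫↓ y

ComputableSet : (ℕ → Set) → Set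
ComputableSet P = Σ (PR 1) λ e → ∀ x →
  (P x × e ⟨ x ∷ [] ⟩↓ 1) ⊎ (¬ P x × e ⟨ x ∷ [] ⟩↓ 0)

ComputableRel : (ℕ → ℕ → Set) → Set
ComputableRel R = Σ (PR 2) λ e → ∀ x y →
  (R x y × e ⟨ x ∷ y ∷ [] ⟩↓ 1) ⊎ (¬ R x y × e ⟨ x ∷ y ∷ [] ⟩↓ 0)

Finite : (ℕ → Set) → Set
Finite X = ∃ λ n → ∀ x → X x → x < n

Infinite : (ℕ → Set) → Set
Infinite X = ¬ Finite X

_⊆*_ : (ℕ → Set) → (ℕ → Set) → Set
X ⊆* Y = Finite (λ i → X i × ¬ Y i)

Cohesive : (ℕ → Set) → Set
Cohesive C = Infinite C × (∀ (e : PR 1) →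
  Finite (λ i → Dom e i × C i) ⊎ Finite (λ i → ¬ Dom e i × C i))

record Graph : Set₁ where
  field
    Carrier : Set
    Adj     : Carrier → Carrier → Set
    Adj-sym : ∀ {x y} → Adj x y → Adj y x
    vertex  : Carrier

record CGraph : Set₁ where
  field
    V      : ℕ → Set
    E      : ℕ → ℕ → Set
    E⊆V×V  : ∀ {x y} → E x y → V x × V y
    E-sym  : ∀ {x y} → E x y → E y x
    vertex : Σ ℕ V
    V-comp : ComputableSet V
    E-comp : ComputableRel E

LocallyFinite : CGraph → Set
LocallyFinite G = ∀ v → V v → Finite (λ u → V u × E v u)
  where open CGraph G

StronglyLocallyFinite : CGraph → Set
StronglyLocallyFinite G = ∀ v → V v → Finite (λ u → V u × Star E v u)
  where open CGraph G

record Struct : Set₁ where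
  field
    Carrier : Set
    _≈_     : Carrier → Carrier → Set
    Adj     : Carrier → Carrier → Set

record Iso (A B : Struct) : Set where
  private
    module A = Struct A
    module B = Struct B
  field
    to       : A.Carrier → B.Carrier
    from     : B.Carrier → A.Carrier
    to-cong  : ∀ {x y} → x A.≈ y → to x B.≈ to y
    from-cong : ∀ {x y} → x B.≈ y → from x A.≈ from y
    from-to  : ∀ x → from (to x) A.≈ x
    to-from  : ∀ y → to (from y) B.≈ y
    Adj-to   : ∀ x y → A.Adj x y → B.Adj (to x) (to y)
    Adj-from : ∀ x y → B.Adj (to x) (to y) → A.Adj x y

_⊔_ : CGraph → Graph → Struct
G ⊔ H = record
  { Carrier = Σ ℕ G.V ⊎ H.Carrier
  ; _≈_ = eq
  ; Adj = adj }
  where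
    module G = CGraph G
    module H = Graph H
    eq : Σ ℕ G.V ⊎ H.Carrier → Σ ℕ G.V ⊎ H.Carrier → Set
    eq (inj₁ a) (inj₁ b) = proj₁ a ≡ proj₁ b
    eq (inj₂ a) (inj₂ b) = a ≡ b
    eq _        _        = ⊥
    adj : Σ ℕ G.V ⊎ H.Carrier → Σ ℕ G.V ⊎ H.Carrier → Set
    adj (inj₁ a) (inj₁ b) = G.E (proj₁ a) (proj₁ b)
    adj (inj₂ a) (inj₂ b) = H.Adj a b
    adj _        _        = ⊥

CohesivePower : (ℕ → Set) → CGraph → Struct
CohesivePower C A = record
  { Carrier = Σ (PR 1) λ ψ → (C ⊆* Dom ψ) × (∀ i y → ψ ⟪ i ⟫↓ y → V y)
  ; _≈_ = λ p q → C ⊆* (λ i → ∃ λ y → (proj₁ p ⟪ i ⟫↓ y) × (proj₁ q ⟪ i ⟫↓ y))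
  ; Adj = λ p q → C ⊆* (λ i → ∃₂ λ y z →
                     (proj₁ p ⟪ i ⟫↓ y) × (proj₁ q ⟪ i ⟫↓ z) × E y z) }
  where open CGraph A

-- Write x = tri n + v with v ≤ n and call n the block and v the offset of x. Let A be the graph on ℕ whose
-- n-th block is a copy of G restricted to {0, …, n}; both coordinates are computable, so A is computable,
-- and its components lie inside blocks, so they are finite. The functions ψ v : i ↦ tri i + v (the vertex v
-- of block i) embed G into ∏_C A, preserving and reflecting adjacency because almost every i is beyond v.
-- The image is a union of components: if [φ] is adjacent to [ψ v], then for almost every i ∈ C the value
-- φ(i) is a vertex u of block i adjacent to v; there are finitely many such u, cohesiveness decides each
-- c.e. set {i : φ(i) = ψ u (i)}, and so one of them contains almost all of C, i.e. [φ] = [ψ u]. A setoid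
-- graph containing G as a union of components is G ⊔ H, where H is the rest.

module Submission where

open import Axiom.ExcludedMiddle using (ExcludedMiddle)
open import Data.Bool.Properties using (T-irrelevant)
open import Data.Empty using (⊥-elim)
open import Data.Fin using (toℕ; #_)
open import Data.Fin.Properties using (toℕ-injective)
open import Data.Maybe using (Maybe; just; _>>=_)
import Data.Maybe as Maybe
open import Data.Maybe.Properties using (just-injective)
open import Data.Nat hiding (_⊔_)
open import Data.Nat.Induction using (<-rec)
open import Data.Nat.Properties
open import Data.Product
open import Function using (_∘_)
open import Data.Sum using (_⊎_; inj₁; inj₂)
open import Data.Unit using (⊤; tt)
open import Data.Vec using (Vec; []; _∷_; head; tail)
open import Level using (0ℓ)
open import Relation.Binary.Definitions using (tri<; tri≈; tri>)
open import Relation.Binary.Construct.Closure.ReflexiveTransitive using (Star; ε; _◅_)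
open import Relation.Binary.PropositionalEquality
open import Relation.Nullary using (¬_; Dec; yes; no)
open import Relation.Nullary.Decidable using (True; toWitness; fromWitness; decidable-stable)

open import Defs

>>=-just : ∀ {A B : Set} (m : Maybe A) {f : A → Maybe B} {y} →
           (m >>= f) ≡ just y → ∃ λ a → m ≡ just a × f a ≡ just y
>>=-just (just a) eq = a , refl , eq

map-just⁻ : ∀ {A B : Set} {f : A → B} (m : Maybe A) {y} →
            Maybe.map f m ≡ just y → ∃ λ a → m ≡ just a × f a ≡ y
map-just⁻ (just a) refl = a , refl , refl

mutual
  eval-suc : ∀ {n} k (e : PR n) xs {y} → eval k e xs ≡ just y → eval (suc k) e xs ≡ just y
  eval-suc (suc k) zeroF xs eq = eq
  eval-suc (suc k) succF (x ∷ []) eq = eq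
  eval-suc (suc k) (projF i) xs eq = eq
  eval-suc (suc k) (compF f gs) xs eq with >>=-just (evalV k gs xs) eq
  ... | ys , gs↓ , f↓ rewrite evalV-suc k gs xs gs↓ = eval-suc k f ys f↓
  eval-suc (suc k) (primF f g) (zero ∷ xs) eq = eval-suc k f xs eq
  eval-suc (suc k) (primF f g) (suc x ∷ xs) eq with >>=-just (eval k (primF f g) (x ∷ xs)) eq
  ... | r , rec↓ , g↓ rewrite eval-suc k (primF f g) (x ∷ xs) rec↓ = eval-suc k g _ g↓
  eval-suc (suc k) (muF f) xs eq = search-suc k f xs 0 eq

  evalV-suc : ∀ {m n} k (gs : Vec (PR n) m) xs {ys} → evalV k gs xs ≡ just ys → evalV (suc k) gs xs ≡ just ys
  evalV-suc k [] xs eq = eq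
  evalV-suc k (g ∷ gs) xs eq with >>=-just (eval k g xs) eq
  ... | r , g↓ , rest with map-just⁻ (evalV k gs xs) rest
  ... | rs , gs↓ , refl rewrite eval-suc k g xs g↓ | evalV-suc k gs xs gs↓ = refl

  search-suc : ∀ {n} k (f : PR (suc n)) xs y {r} → search k f xs y ≡ just r → search (suc k) f xs y ≡ just r
  search-suc (suc k) f xs y eq with eval k f (y ∷ xs) in f↓
  ... | just zero rewrite eval-suc k f _ f↓ = eq
  ... | just (suc _) rewrite eval-suc k f _ f↓ = search-suc k f xs (suc y) eq

just-stable : ∀ {A : Set} (f : ℕ → Maybe A) → (∀ {k y} → f k ≡ just y → f (suc k) ≡ just y) →
              ∀ {k k' y} → k ≤ k' → f k ≡ just y → f k' ≡ just y
just-stable f step k≤k' = go (≤⇒≤′ k≤k')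
  where
  go : ∀ {k k' y} → k ≤′ k' → f k ≡ just y → f k' ≡ just y
  go ≤′-refl       fk = fk
  go (≤′-step k≤′) fk = step (go k≤′ fk)

eval-mono : ∀ {n k k'} (e : PR n) xs {y} → k ≤ k' → eval k e xs ≡ just y → eval k' e xs ≡ just y
eval-mono e xs = just-stable (λ k → eval k e xs) (λ {k} → eval-suc k e xs)

evalV-mono : ∀ {m n k k'} (gs : Vec (PR n) m) xs {ys} → k ≤ k' → evalV k gs xs ≡ just ys → evalV k' gs xs ≡ just ys
evalV-mono gs xs = just-stable (λ k → evalV k gs xs) (λ {k} → evalV-suc k gs xs)

search-mono : ∀ {n k k'} (f : PR (suc n)) xs y {r} → k ≤ k' → search k f xs y ≡ just r → search k' f xs y ≡ just r
search-mono f xs y = just-stable (λ k → search k f xs y) (λ {k} → search-suc k f xs y)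

↓-functional : ∀ {n} {e : PR n} {xs a b} → e ⟨ xs ⟩↓ a → e ⟨ xs ⟩↓ b → a ≡ b
↓-functional {e = e} {xs} (s , e↓a) (t , e↓b) =
  just-injective (trans (sym (eval-mono e xs (m≤m+n s t) e↓a)) (eval-mono e xs (m≤n+m t s) e↓b))

_⟨_⟩↓*_ : ∀ {m n} → Vec (PR n) m → Vec ℕ n → Vec ℕ m → Set
gs ⟨ xs ⟩↓* ys = ∃ λ s → evalV s gs xs ≡ just ys

[]↓ : ∀ {n} {xs : Vec ℕ n} → [] ⟨ xs ⟩↓* []
[]↓ = 0 , refl

∷↓ : ∀ {m n} {g : PR n} {gs : Vec (PR n) m} {xs y ys} →
     g ⟨ xs ⟩↓ y → gs ⟨ xs ⟩↓* ys → (g ∷ gs) ⟨ xs ⟩↓* (y ∷ ys)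
∷↓ {g = g} {gs} {xs} {y} {ys} (s , g↓) (t , gs↓) = s + t , eq
  where
  eq : evalV (s + t) (g ∷ gs) xs ≡ just (y ∷ ys)
  eq rewrite eval-mono g xs (m≤m+n s t) g↓ | evalV-mono gs xs (m≤n+m t s) gs↓ = refl

∷↓⁻ : ∀ {m n} {g : PR n} {gs : Vec (PR n) m} {xs y ys} →
      (g ∷ gs) ⟨ xs ⟩↓* (y ∷ ys) → (g ⟨ xs ⟩↓ y) × (gs ⟨ xs ⟩↓* ys)
∷↓⁻ {g = g} {gs} {xs} (s , eq) with >>=-just (eval s g xs) eq
... | r , g↓ , rest with map-just⁻ (evalV s gs xs) rest
... | rs , gs↓ , refl = (s , g↓) , (s , gs↓)

compF↓ : ∀ {m n} {f : PR m} {gs : Vec (PR n) m} {xs ys y} →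
         gs ⟨ xs ⟩↓* ys → f ⟨ ys ⟩↓ y → compF f gs ⟨ xs ⟩↓ y
compF↓ {f = f} {gs} {xs} {ys} {y} (s , gs↓) (t , f↓) = suc (s + t) , eq
  where
  eq : eval (suc (s + t)) (compF f gs) xs ≡ just y
  eq rewrite evalV-mono gs xs (m≤m+n s t) gs↓ = eval-mono f ys (m≤n+m t s) f↓

compF↓⁻ : ∀ {m n} {f : PR m} {gs : Vec (PR n) m} {xs y} →
          compF f gs ⟨ xs ⟩↓ y → ∃ λ ys → (gs ⟨ xs ⟩↓* ys) × (f ⟨ ys ⟩↓ y)
compF↓⁻ {gs = gs} {xs} (suc s , eq) with >>=-just (evalV s gs xs) eq
... | ys , gs↓ , f↓ = ys , (s , gs↓) , (s , f↓)

muF↓⁻ : ∀ {n} {f : PR (suc n)} {xs r} → muF f ⟨ xs ⟩↓ r → ∃ λ z → f ⟨ z ∷ xs ⟩↓ 0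
muF↓⁻ {f = f} {xs} (suc s , eq) = go s 0 eq
  where
  go : ∀ k y {r} → search k f xs y ≡ just r → ∃ λ z → f ⟨ z ∷ xs ⟩↓ 0
  go (suc k) y eq with eval k f (y ∷ xs) in f↓
  ... | just zero    = y , k , f↓
  ... | just (suc _) = go k (suc y) eq

muF↓-0 : ∀ {n} {f : PR (suc n)} {xs} → f ⟨ 0 ∷ xs ⟩↓ 0 → muF f ⟨ xs ⟩↓ 0
muF↓-0 {f = f} {xs} (s , f↓) = suc (suc s) , eq
  where
  eq : eval (suc (suc s)) (muF f) xs ≡ just 0
  eq rewrite f↓ = refl

infix 30 _∘⟨_⟩ _∘⟪_,_⟫

_∘⟨_⟩ : ∀ {n} → PR 1 → PR n → PR n
f ∘⟨ g ⟩ = compF f (g ∷ [])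

_∘⟪_,_⟫ : ∀ {n} → PR 2 → PR n → PR n → PR n
f ∘⟪ g , h ⟫ = compF f (g ∷ h ∷ [])

∘₁↓ : ∀ {n} {f : PR 1} {g : PR n} {xs a y} → g ⟨ xs ⟩↓ a → f ⟨ a ∷ [] ⟩↓ y → f ∘⟨ g ⟩ ⟨ xs ⟩↓ y
∘₁↓ {g = g} {xs} g↓ f↓ = compF↓ (∷↓ {g = g} {gs = []} g↓ ([]↓ {xs = xs})) f↓

∘₂↓ : ∀ {n} {f : PR 2} {g h : PR n} {xs a b y} →
      g ⟨ xs ⟩↓ a → h ⟨ xs ⟩↓ b → f ⟨ a ∷ b ∷ [] ⟩↓ y → f ∘⟪ g , h ⟫ ⟨ xs ⟩↓ y
∘₂↓ {g = g} {h} {xs} g↓ h↓ f↓ =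
  compF↓ (∷↓ {g = g} {gs = h ∷ []} g↓ (∷↓ {g = h} {gs = []} h↓ ([]↓ {xs = xs}))) f↓

∘₁↓⁻ : ∀ {n} {f : PR 1} {g : PR n} {xs y} → f ∘⟨ g ⟩ ⟨ xs ⟩↓ y → ∃ λ a → (g ⟨ xs ⟩↓ a) × (f ⟨ a ∷ [] ⟩↓ y)
∘₁↓⁻ {f = f} {g} c with compF↓⁻ {f = f} {gs = g ∷ []} c
... | (a ∷ []) , gs↓ , f↓ = a , proj₁ (∷↓⁻ {g = g} {gs = []} gs↓) , f↓

∘₂↓⁻ : ∀ {n} {f : PR 2} {g h : PR n} {xs y} → f ∘⟪ g , h ⟫ ⟨ xs ⟩↓ y →
       ∃₂ λ a b → (g ⟨ xs ⟩↓ a) × (h ⟨ xs ⟩↓ b) × (f ⟨ a ∷ b ∷ [] ⟩↓ y)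
∘₂↓⁻ {f = f} {g} {h} c with compF↓⁻ {f = f} {gs = g ∷ h ∷ []} c
... | (a ∷ b ∷ []) , gs↓ , f↓ with ∷↓⁻ {g = g} {gs = h ∷ []} gs↓
... | g↓ , hs↓ = a , b , g↓ , proj₁ (∷↓⁻ {g = h} {gs = []} hs↓) , f↓

Computes : ∀ {n} → PR n → (Vec ℕ n → ℕ) → Set
Computes e F = ∀ xs → e ⟨ xs ⟩↓ F xs

computes-ext : ∀ {n} {e : PR n} {F G : Vec ℕ n → ℕ} → Computes e F → (∀ xs → F xs ≡ G xs) → Computes e G
computes-ext {e = e} e↓ F≗G xs = subst (e ⟨ xs ⟩↓_) (F≗G xs) (e↓ xs)

zeroF-computes : ∀ {n} → Computes (zeroF {n}) (λ _ → 0)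
zeroF-computes xs = 1 , refl

succF-computes : Computes succF (λ xs → suc (head xs))
succF-computes (x ∷ []) = 1 , refl

proj₀-computes : ∀ {n} → Computes (projF {suc n} (# 0)) head
proj₀-computes (x ∷ xs) = 1 , refl

proj₁-computes : ∀ {n} → Computes (projF {suc (suc n)} (# 1)) (λ xs → head (tail xs))
proj₁-computes (x ∷ y ∷ xs) = 1 , refl

∘₁-computes : ∀ {n} {f : PR 1} {g : PR n} {F G} → Computes f F → Computes g G →
              Computes (f ∘⟨ g ⟩) (λ xs → F (G xs ∷ []))
∘₁-computes {F = F} {G} f↓ g↓ xs = ∘₁↓ (g↓ xs) (f↓ (G xs ∷ []))

∘₂-computes : ∀ {n} {f : PR 2} {g h : PR n} {F G H} → Computes f F → Computes g G → Computes h H →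
              Computes (f ∘⟪ g , h ⟫) (λ xs → F (G xs ∷ H xs ∷ []))
∘₂-computes {F = F} {G} {H} f↓ g↓ h↓ xs = ∘₂↓ (g↓ xs) (h↓ xs) (f↓ (G xs ∷ H xs ∷ []))

primRec : ∀ {n} → (Vec ℕ n → ℕ) → (Vec ℕ (suc (suc n)) → ℕ) → Vec ℕ (suc n) → ℕ
primRec F G (zero  ∷ xs) = F xs
primRec F G (suc x ∷ xs) = G (x ∷ primRec F G (x ∷ xs) ∷ xs)

primF-computes : ∀ {n} {f : PR n} {g F G} → Computes f F → Computes g G → Computes (primF f g) (primRec F G)
primF-computes f↓ g↓ (zero ∷ xs) with f↓ xs
... | s , eq = suc s , eq
primF-computes {f = f} {g} {F} {G} f↓ g↓ (suc x ∷ xs)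
  with primF-computes {f = f} {g} f↓ g↓ (x ∷ xs) | g↓ (x ∷ primRec F G (x ∷ xs) ∷ xs)
... | s , rec↓ | t , step↓ = suc (s + t) , eq
  where
  eq : eval (suc (s + t)) (primF f g) (suc x ∷ xs) ≡ just (primRec F G (suc x ∷ xs))
  eq rewrite eval-mono (primF f g) (x ∷ xs) (m≤m+n s t) rec↓ = eval-mono g _ (m≤n+m t s) step↓

muF-computes : ∀ {n} {f : PR (suc n)} {F} → Computes f F → ∀ xs t →
               F (t ∷ xs) ≡ 0 → (∀ z → z < t → F (z ∷ xs) ≢ 0) → muF f ⟨ xs ⟩↓ t
muF-computes {f = f} {F} f↓ xs t Ft≡0 F<t≢0 = let s , found = search-from t 0 refl in suc s , found
  where
  search-from : ∀ d y → y + d ≡ t → ∃ λ s → search s f xs y ≡ just t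
  search-from zero y y≡t rewrite +-identityʳ y | y≡t with f↓ (t ∷ xs)
  ... | s , f↓t rewrite Ft≡0 = suc s , eq
    where
    eq : search (suc s) f xs t ≡ just t
    eq rewrite f↓t = refl
  search-from (suc d) y y+d≡t with f↓ (y ∷ xs) | search-from d (suc y) (trans (sym (+-suc y d)) y+d≡t)
  ... | s , f↓y | s' , rest with F (y ∷ xs) in Fy
  ... | zero  = ⊥-elim (F<t≢0 y (subst (y <_) y+d≡t (m<m+n y z<s)) Fy)
  ... | suc _ = suc (s + s') , eq
    where
    eq : search (suc (s + s')) f xs y ≡ just t
    eq rewrite eval-mono f (y ∷ xs) (m≤m+n s s') f↓y = search-mono f xs (suc y) (m≤n+m s' s) rest

tri : ℕ → ℕ
tri zero    = 0
tri (suc n) = tri n + suc n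

tri-mono : ∀ {m n} → m ≤ n → tri m ≤ tri n
tri-mono m≤n = go (≤⇒≤′ m≤n)
  where
  go : ∀ {m n} → m ≤′ n → tri m ≤ tri n
  go ≤′-refl       = ≤-refl
  go (≤′-step m≤′n) = ≤-trans (go m≤′n) (m≤m+n _ _)

tri+<tri-suc : ∀ {n v} → v ≤ n → tri n + v < tri (suc n)
tri+<tri-suc {n} v≤n = +-monoʳ-< (tri n) (s≤s v≤n)

tri+<tri+ : ∀ {n n' v v'} → v ≤ n → n < n' → tri n + v < tri n' + v'
tri+<tri+ {v' = v'} v≤n n<n' = <-≤-trans (tri+<tri-suc v≤n) (≤-trans (tri-mono n<n') (m≤m+n _ v'))

tri-decomposition-unique : ∀ {n n' v v'} → v ≤ n → v' ≤ n' → tri n + v ≡ tri n' + v' → n ≡ n' × v ≡ v'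
tri-decomposition-unique {n} {n'} v≤n v'≤n' eq with <-cmp n n'
... | tri< n<n' _ _ = ⊥-elim (<⇒≢ (tri+<tri+ v≤n n<n') eq)
... | tri> _ _ n'<n = ⊥-elim (<⇒≢ (tri+<tri+ v'≤n' n'<n) (sym eq))
... | tri≈ _ refl _ = refl , +-cancelˡ-≡ (tri n) _ _ eq

tri-decomposition : ∀ x → ∃₂ λ n v → v ≤ n × x ≡ tri n + v
tri-decomposition zero = 0 , 0 , z≤n , refl
tri-decomposition (suc x) with tri-decomposition x
... | n , v , v≤n , x≡ with m≤n⇒m<n∨m≡n v≤n
...   | inj₁ v<n  = n , suc v , v<n , trans (cong suc x≡) (sym (+-suc (tri n) v))
...   | inj₂ refl = suc n , 0 , z≤n , trans (cong suc x≡) (trans (sym (+-suc (tri n) n)) (sym (+-identityʳ _)))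

block offset : ℕ → ℕ
block  x = proj₁ (tri-decomposition x)
offset x = proj₁ (proj₂ (tri-decomposition x))

offset≤block : ∀ x → offset x ≤ block x
offset≤block x = proj₁ (proj₂ (proj₂ (tri-decomposition x)))

tri-block+offset : ∀ x → x ≡ tri (block x) + offset x
tri-block+offset x = proj₂ (proj₂ (proj₂ (tri-decomposition x)))

block-tri+ : ∀ {n v} → v ≤ n → block (tri n + v) ≡ n
block-tri+ {n} {v} v≤n =
  proj₁ (tri-decomposition-unique (offset≤block (tri n + v)) v≤n (sym (tri-block+offset (tri n + v))))

offset-tri+ : ∀ {n v} → v ≤ n → offset (tri n + v) ≡ v
offset-tri+ {n} {v} v≤n =
  proj₂ (tri-decomposition-unique (offset≤block (tri n + v)) v≤n (sym (tri-block+offset (tri n + v))))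

π₀ : ∀ {n} → PR (suc n)
π₀ = projF (# 0)

π₁ : ∀ {n} → PR (suc (suc n))
π₁ = projF (# 1)

constᶜ : ∀ {n} → ℕ → PR n
constᶜ zero    = zeroF
constᶜ (suc k) = succF ∘⟨ constᶜ k ⟩

constᶜ-computes : ∀ {n} k → Computes (constᶜ {n} k) (λ _ → k)
constᶜ-computes zero    = zeroF-computes
constᶜ-computes (suc k) = ∘₁-computes succF-computes (constᶜ-computes k)

predᶜ : PR 1
predᶜ = primF zeroF π₀

predᶜ-computes : Computes predᶜ (λ xs → pred (head xs))
predᶜ-computes = computes-ext (primF-computes zeroF-computes proj₀-computes)
  λ { (zero ∷ []) → refl ; (suc x ∷ []) → refl }

addᶜ : PR 2
addᶜ = primF π₀ (succF ∘⟨ π₁ ⟩)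

addᶜ-computes : Computes addᶜ (λ xs → head xs + head (tail xs))
addᶜ-computes = computes-ext (primF-computes proj₀-computes (∘₁-computes succF-computes proj₁-computes)) sum
  where
  sum : ∀ xs → primRec head (λ ys → suc (head (tail ys))) xs ≡ head xs + head (tail xs)
  sum (zero  ∷ y ∷ []) = refl
  sum (suc x ∷ y ∷ []) = cong suc (sum (x ∷ y ∷ []))

-- The recursion runs on the subtrahend, which is therefore the first argument.
monusᶜ : PR 2
monusᶜ = primF π₀ (predᶜ ∘⟨ π₁ ⟩)

monusᶜ-computes : Computes monusᶜ (λ xs → head (tail xs) ∸ head xs)
monusᶜ-computes = computes-ext (primF-computes proj₀-computes (∘₁-computes predᶜ-computes proj₁-computes)) diff
  where
  diff : ∀ xs → primRec head (λ ys → pred (head (tail ys))) xs ≡ head (tail xs) ∸ head xs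
  diff (zero  ∷ x ∷ []) = refl
  diff (suc y ∷ x ∷ []) = trans (cong pred (diff (y ∷ x ∷ []))) (pred[m∸n]≡m∸[1+n] x y)

triᶜ : PR 1
triᶜ = primF zeroF (addᶜ ∘⟪ π₁ , succF ∘⟨ π₀ ⟩ ⟫)

triᶜ-computes : Computes triᶜ (λ xs → tri (head xs))
triᶜ-computes = computes-ext
  (primF-computes zeroF-computes (∘₂-computes addᶜ-computes proj₁-computes (∘₁-computes succF-computes proj₀-computes)))
  triangular
  where
  triangular : ∀ xs → primRec (λ _ → 0) (λ ys → head (tail ys) + suc (head ys)) xs ≡ tri (head xs)
  triangular (zero  ∷ []) = refl
  triangular (suc x ∷ []) = cong (_+ suc x) (triangular (x ∷ []))

infixl 6 _+ᶜ_ _∸ᶜ_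

_+ᶜ_ _∸ᶜ_ : ∀ {n} → PR n → PR n → PR n
a +ᶜ b = addᶜ ∘⟪ a , b ⟫
a ∸ᶜ b = monusᶜ ∘⟪ b , a ⟫

+ᶜ-computes : ∀ {n} {a b : PR n} {A B} → Computes a A → Computes b B → Computes (a +ᶜ b) (λ xs → A xs + B xs)
+ᶜ-computes = ∘₂-computes addᶜ-computes

∸ᶜ-computes : ∀ {n} {a b : PR n} {A B} → Computes a A → Computes b B → Computes (a ∸ᶜ b) (λ xs → A xs ∸ B xs)
∸ᶜ-computes a↓ b↓ = ∘₂-computes monusᶜ-computes b↓ a↓

∸+∸≡∣-∣ : ∀ m n → (m ∸ n) + (n ∸ m) ≡ ∣ m - n ∣
∸+∸≡∣-∣ zero    n       = cong₂ _+_ (0∸n≡0 n) refl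
∸+∸≡∣-∣ (suc m) zero    = +-identityʳ (suc m)
∸+∸≡∣-∣ (suc m) (suc n) = ∸+∸≡∣-∣ m n

distᶜ : PR 2
distᶜ = (π₀ ∸ᶜ π₁) +ᶜ (π₁ ∸ᶜ π₀)

distᶜ-computes : Computes distᶜ (λ xs → ∣ head xs - head (tail xs) ∣)
distᶜ-computes = computes-ext
  (+ᶜ-computes (∸ᶜ-computes proj₀-computes proj₁-computes) (∸ᶜ-computes proj₁-computes proj₀-computes))
  λ { (x ∷ y ∷ []) → ∸+∸≡∣-∣ x y }

blockTestᶜ : PR 2
blockTestᶜ = constᶜ 1 ∸ᶜ (triᶜ ∘⟨ succF ∘⟨ π₀ ⟩ ⟩ ∸ᶜ π₁)

blockTestᶜ-computes : Computes blockTestᶜ (λ xs → 1 ∸ (tri (suc (head xs)) ∸ head (tail xs)))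
blockTestᶜ-computes = ∸ᶜ-computes (constᶜ-computes 1)
  (∸ᶜ-computes (∘₁-computes triᶜ-computes (∘₁-computes succF-computes proj₀-computes)) proj₁-computes)

-- block x is the least z with x < tri (suc z), i.e. the least root of blockTestᶜ (z, x).
blockᶜ : PR 1
blockᶜ = muF blockTestᶜ

blockᶜ-computes : Computes blockᶜ (λ xs → block (head xs))
blockᶜ-computes (x ∷ []) = muF-computes blockTestᶜ-computes (x ∷ []) (block x) at-block below-block
  where
  x<tri-suc-block : x < tri (suc (block x))
  x<tri-suc-block = subst (_< tri (suc (block x))) (sym (tri-block+offset x)) (tri+<tri-suc (offset≤block x))
  at-block : 1 ∸ (tri (suc (block x)) ∸ x) ≡ 0
  at-block with tri (suc (block x)) ∸ x | m<n⇒0<n∸m x<tri-suc-block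
  ... | suc k | _ = 0∸n≡0 k
  below-block : ∀ z → z < block x → 1 ∸ (tri (suc z) ∸ x) ≢ 0
  below-block z z<block rewrite m≤n⇒m∸n≡0 (≤-trans (tri-mono z<block)
                                 (subst (tri (block x) ≤_) (sym (tri-block+offset x)) (m≤m+n _ _))) = λ ()

offsetᶜ : PR 1
offsetᶜ = π₀ ∸ᶜ triᶜ ∘⟨ blockᶜ ⟩

offsetᶜ-computes : Computes offsetᶜ (λ xs → offset (head xs))
offsetᶜ-computes = computes-ext (∸ᶜ-computes proj₀-computes (∘₁-computes triᶜ-computes blockᶜ-computes))
  λ { (x ∷ []) → trans (cong (_∸ tri (block x)) (tri-block+offset x)) (m+n∸m≡n (tri (block x)) (offset x)) }

agreeᶜ : PR 1 → PR 1 → PR 1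
agreeᶜ φ χ = muF (distᶜ ∘⟪ φ ∘⟨ π₁ ⟩ , χ ∘⟨ π₁ ⟩ ⟫)

agree⇒Dom : ∀ {φ χ i y} → φ ⟪ i ⟫↓ y → χ ⟪ i ⟫↓ y → Dom (agreeᶜ φ χ) i
agree⇒Dom {φ} {χ} {i} {y} φ↓ χ↓ = 0 , muF↓-0 (∘₂↓ (∘₁↓ π₁↓ φ↓) (∘₁↓ π₁↓ χ↓) dist↓0)
  where
  π₁↓ : π₁ ⟨ 0 ∷ i ∷ [] ⟩↓ i
  π₁↓ = proj₁-computes (0 ∷ i ∷ [])
  dist↓0 : distᶜ ⟨ y ∷ y ∷ [] ⟩↓ 0
  dist↓0 = subst (distᶜ ⟨ y ∷ y ∷ [] ⟩↓_) (∣n-n∣≡0 y) (distᶜ-computes (y ∷ y ∷ []))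

∘π₁↓⁻ : ∀ {f : PR 1} {z i a} → f ∘⟨ π₁ ⟩ ⟨ z ∷ i ∷ [] ⟩↓ a → f ⟪ i ⟫↓ a
∘π₁↓⁻ {f} {z} {i} {a} f∘π₁↓ = read (∘₁↓⁻ {f = f} {g = π₁} f∘π₁↓)
  where
  read : (∃ λ j → π₁ ⟨ z ∷ i ∷ [] ⟩↓ j × f ⟨ j ∷ [] ⟩↓ a) → f ⟪ i ⟫↓ a
  read (j , π₁↓j , f↓) = subst (λ j → f ⟨ j ∷ [] ⟩↓ a) (↓-functional π₁↓j (proj₁-computes (z ∷ i ∷ []))) f↓

Dom⇒agree : ∀ {φ χ i} → Dom (agreeᶜ φ χ) i → ∃ λ y → φ ⟪ i ⟫↓ y × χ ⟪ i ⟫↓ y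
Dom⇒agree {φ} {χ} {i} (_ , agree↓) = agreeing (proj₂ (muF↓⁻ agree↓))
  where
  agreeing : ∀ {z} → distᶜ ∘⟪ φ ∘⟨ π₁ ⟩ , χ ∘⟨ π₁ ⟩ ⟫ ⟨ z ∷ i ∷ [] ⟩↓ 0 → ∃ λ y → φ ⟪ i ⟫↓ y × χ ⟪ i ⟫↓ y
  agreeing {z} test↓0 = common-value (∘₂↓⁻ {f = distᶜ} {g = φ ∘⟨ π₁ ⟩} {h = χ ∘⟨ π₁ ⟩} test↓0)
    where
    common-value : (∃₂ λ a b → φ ∘⟨ π₁ ⟩ ⟨ z ∷ i ∷ [] ⟩↓ a × χ ∘⟨ π₁ ⟩ ⟨ z ∷ i ∷ [] ⟩↓ b × distᶜ ⟨ a ∷ b ∷ [] ⟩↓ 0) →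
            ∃ λ y → φ ⟪ i ⟫↓ y × χ ⟪ i ⟫↓ y
    common-value (a , b , φ↓a , χ↓b , dist↓0) =
      a , ∘π₁↓⁻ φ↓a ,
      subst (χ ⟪ i ⟫↓_) (sym (∣m-n∣≡0⇒m≡n {a} {b} (↓-functional (distᶜ-computes (a ∷ b ∷ [])) dist↓0))) (∘π₁↓⁻ χ↓b)

pair : ℕ → ℕ → ℕ
pair a b = tri (a + b) + b

pair-injective : ∀ a b a' b' → pair a b ≡ pair a' b' → a ≡ a' × b ≡ b'
pair-injective a b a' b' eq with tri-decomposition-unique (m≤n+m b a) (m≤n+m b' a') eq
... | a+b≡a'+b' , refl = +-cancelʳ-≡ b a a' a+b≡a'+b' , refl

tag : ∀ {n} → PR n → ℕ
tag zeroF       = 0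
tag succF       = 1
tag (projF _)   = 2
tag (compF _ _) = 3
tag (primF _ _) = 4
tag (muF _)     = 5

mutual
  encode : ∀ {n} → PR n → ℕ
  encode e = pair (tag e) (payload e)

  payload : ∀ {n} → PR n → ℕ
  payload zeroF            = 0
  payload succF            = 0
  payload (projF i)        = toℕ i
  payload (compF {m} f gs) = pair m (pair (encode f) (encodeVec gs))
  payload (primF f g)      = pair (encode f) (encode g)
  payload (muF f)          = encode f

  encodeVec : ∀ {m n} → Vec (PR n) m → ℕ
  encodeVec []       = 0
  encodeVec (g ∷ gs) = suc (pair (encode g) (encodeVec gs))

mutual
  encode-injective : ∀ {n} {a b : PR n} → encode a ≡ encode b → a ≡ b
  encode-injective {a = a} {b} eq = tag-payload-injective a b (pair-injective _ (payload a) _ (payload b) eq)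

  -- Pairs of constructors with different tags are discharged by the coverage checker.
  tag-payload-injective : ∀ {n} (a b : PR n) → tag a ≡ tag b × payload a ≡ payload b → a ≡ b
  tag-payload-injective zeroF zeroF _ = refl
  tag-payload-injective succF succF _ = refl
  tag-payload-injective (projF i) (projF j) (_ , i≡j) = cong projF (toℕ-injective i≡j)
  tag-payload-injective (compF {m} f gs) (compF {m'} f' gs') (_ , eq)
    with pair-injective m _ m' _ eq
  ... | refl , eq' with pair-injective (encode f) (encodeVec gs) (encode f') (encodeVec gs') eq'
  ... | f≡ , gs≡ = cong₂ compF (encode-injective f≡) (encodeVec-injective gs≡)
  tag-payload-injective (primF f g) (primF f' g') (_ , eq) with pair-injective (encode f) (encode g) (encode f') (encode g') eq
  ... | f≡ , g≡ = cong₂ primF (encode-injective f≡) (encode-injective g≡)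
  tag-payload-injective (muF f) (muF f') (_ , eq) = cong muF (encode-injective eq)

  encodeVec-injective : ∀ {m n} {gs gs' : Vec (PR n) m} → encodeVec gs ≡ encodeVec gs' → gs ≡ gs'
  encodeVec-injective {gs = []} {[]} _ = refl
  encodeVec-injective {gs = g ∷ gs} {g' ∷ gs'} eq
    with pair-injective (encode g) (encodeVec gs) (encode g') (encodeVec gs') (suc-injective eq)
  ... | g≡ , gs≡ = cong₂ _∷_ (encode-injective g≡) (encodeVec-injective gs≡)

module _ {C : ℕ → Set} where

  ⊆*-mono : ∀ {P Q : ℕ → Set} → (∀ i → P i → Q i) → C ⊆* P → C ⊆* Q
  ⊆*-mono P⇒Q (n , C∖P<n) = n , λ i (Ci , ¬Qi) → C∖P<n i (Ci , λ Pi → ¬Qi (P⇒Q i Pi))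

  -- Constructive because the bound i < n + m is decidable.
  ⊆*-∩ : ∀ {P Q : ℕ → Set} → C ⊆* P → C ⊆* Q → C ⊆* (λ i → P i × Q i)
  ⊆*-∩ (n , C∖P<n) (m , C∖Q<m) = n + m , λ i (Ci , ¬PQ) → decidable-stable (i <? n + m) λ i≮n+m →
    let ¬¬P = λ ¬Pi → i≮n+m (<-≤-trans (C∖P<n i (Ci , ¬Pi)) (m≤m+n n m))
        ¬¬Q = λ ¬Qi → i≮n+m (<-≤-trans (C∖Q<m i (Ci , ¬Qi)) (m≤n+m m n))
    in ¬¬P λ Pi → ¬¬Q λ Qi → ¬PQ (Pi , Qi)

  ⊆*-cofinite : ∀ {P : ℕ → Set} n → (∀ i → n ≤ i → P i) → C ⊆* P
  ⊆*-cofinite n P≥n = n , λ i (_ , ¬Pi) → decidable-stable (i <? n) λ i≮n → ¬Pi (P≥n i (≮⇒≥ i≮n))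

  ⊆*-witness : ExcludedMiddle 0ℓ → Infinite C → ∀ {P : ℕ → Set} → C ⊆* P → ∀ m → ∃ λ i → m ≤ i × C i × P i
  ⊆*-witness em C-infinite {P} (n , C∖P<n) m with em {∃ λ i → m ≤ i × C i × P i}
  ... | yes witness = witness
  ... | no ∄witness = ⊥-elim (C-infinite (n + m , C<n+m))
    where
    C<n+m : ∀ i → C i → i < n + m
    C<n+m i Ci with m ≤? i
    ... | no  m≰i = <-≤-trans (≰⇒> m≰i) (m≤n+m m n)
    ... | yes m≤i = <-≤-trans (C∖P<n i (Ci , λ Pi → ∄witness (i , m≤i , Ci , Pi))) (m≤m+n n m)

  cohesive-split : Cohesive C → ∀ e → C ⊆* Dom e ⊎ C ⊆* (λ i → ¬ Dom e i)
  cohesive-split (_ , split) e with split e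
  ... | inj₂ (n , C∖W<n) = inj₁ (n , λ i (Ci , ¬Wi) → C∖W<n i (¬Wi , Ci))
  ... | inj₁ (n , W∩C<n) = inj₂ (n , λ i (Ci , ¬¬Wi) →
          decidable-stable (i <? n) λ i≮n → ¬¬Wi λ Wi → i≮n (W∩C<n i (Wi , Ci)))

  cohesive-split-family : Cohesive C → (W : ℕ → PR 1) → ∀ b →
    (∃ λ u → u < b × C ⊆* Dom (W u)) ⊎ C ⊆* (λ i → ∀ u → u < b → ¬ Dom (W u) i)
  cohesive-split-family coh W zero = inj₂ (⊆*-cofinite 0 λ i _ u ())
  cohesive-split-family coh W (suc b) with cohesive-split-family coh W b
  ... | inj₁ (u , u<b , C⊆*Wu) = inj₁ (u , m<n⇒m<1+n u<b , C⊆*Wu)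
  ... | inj₂ C⊆*∁W<b with cohesive-split coh (W b)
  ...   | inj₁ C⊆*Wb  = inj₁ (b , n<1+n b , C⊆*Wb)
  ...   | inj₂ C⊆*∁Wb = inj₂ (⊆*-mono extend (⊆*-∩ C⊆*∁W<b C⊆*∁Wb))
    where
    extend : ∀ i → (∀ u → u < b → ¬ Dom (W u) i) × ¬ Dom (W b) i → ∀ u → u < suc b → ¬ Dom (W u) i
    extend i (∁W<b , ∁Wb) u u<1+b with m<1+n⇒m<n∨m≡n u<1+b
    ... | inj₁ u<b  = ∁W<b u u<b
    ... | inj₂ refl = ∁Wb

least : ExcludedMiddle 0ℓ → {P : ℕ → Set} → ∀ n → P n → ∃ λ m → P m × (∀ k → P k → m ≤ k)
least em {P} = <-rec (λ n → P n → ∃ λ m → P m × (∀ k → P k → m ≤ k)) step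
  where
  step : ∀ n → (∀ {k} → k < n → P k → ∃ λ m → P m × (∀ k → P k → m ≤ k)) → P n →
         ∃ λ m → P m × (∀ k → P k → m ≤ k)
  step n below Pn with em {∃ λ k → k < n × P k}
  ... | yes (k , k<n , Pk) = below k<n Pk
  ... | no ∄smaller        = n , Pn , λ k Pk → ≮⇒≥ λ k<n → ∄smaller (k , k<n , Pk)

record IsGraphSetoid (P : Struct) : Set where
  open Struct P
  field
    ≈-refl   : ∀ x → x ≈ x
    ≈-sym    : ∀ {x y} → x ≈ y → y ≈ x
    ≈-trans  : ∀ {x y z} → x ≈ y → y ≈ z → x ≈ z
    Adj-sym  : ∀ {x y} → Adj x y → Adj y x
    Adj-resp : ∀ {x x' y y'} → x ≈ x' → y ≈ y' → Adj x y → Adj x' y'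

record ComponentEmbedding (G : CGraph) (P : Struct) : Set where
  open Struct P
  open CGraph G using (V; E)
  field
    embed           : ℕ → Carrier
    embed-injective : ∀ {v u} → embed v ≈ embed u → v ≡ u
    embed-Adj       : ∀ {v u} → E v u → Adj (embed v) (embed u)
    embed-Adj⁻      : ∀ {v u} → Adj (embed v) (embed u) → E v u
    embed-closed    : ∀ {v x} → V v → Adj (embed v) x → ∃ λ u → V u × x ≈ embed u
    outsider        : Carrier
    outsider-∉      : ∀ v → ¬ outsider ≈ embed v

-- For lack of quotient types, a vertex of H is the least code of a ≈-class outside the image of embed,
-- paired with the proof-irrelevant evidence (via em) that it is one.
module Splitting (em : ExcludedMiddle 0ℓ) {G : CGraph} {P : Struct} (P-isGraphSetoid : IsGraphSetoid P)
                 (code : Struct.Carrier P → ℕ) (code-injective : ∀ {x y} → code x ≡ code y → Struct._≈_ P x y)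
                 (ι : ComponentEmbedding G P) where
  open Struct P
  open IsGraphSetoid P-isGraphSetoid
  open ComponentEmbedding ι
  open CGraph G using (V; E)

  Embedded : Carrier → Set
  Embedded x = ∃ λ v → V v × x ≈ embed v

  embedded-resp : ∀ {x y} → x ≈ y → Embedded x → Embedded y
  embedded-resp x≈y (v , Vv , x≈v) = v , Vv , ≈-trans (≈-sym x≈y) x≈v

  LeastCode : ℕ → Set
  LeastCode n = ∃ λ x → code x ≡ n × ¬ Embedded x × (∀ y → y ≈ x → n ≤ code y)

  Class : Set
  Class = Σ ℕ λ n → True (em {LeastCode n})

  rep : Class → Carrier
  rep (_ , least-code) = proj₁ (toWitness least-code)

  code-rep : ∀ c → code (rep c) ≡ proj₁ c
  code-rep (_ , least-code) = proj₁ (proj₂ (toWitness least-code))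

  rep-∉ : ∀ c → ¬ Embedded (rep c)
  rep-∉ (_ , least-code) = proj₁ (proj₂ (proj₂ (toWitness least-code)))

  rep-least : ∀ c y → y ≈ rep c → proj₁ c ≤ code y
  rep-least (_ , least-code) = proj₂ (proj₂ (proj₂ (toWitness least-code)))

  class-≡ : ∀ c c' → rep c ≈ rep c' → c ≡ c'
  class-≡ c@(n , t) c'@(n' , t') c≈c' with ≤-antisym (subst (n ≤_) (code-rep c') (rep-least c (rep c') (≈-sym c≈c')))
                                                       (subst (n' ≤_) (code-rep c) (rep-least c' (rep c) c≈c'))
  ... | refl = cong (n ,_) (T-irrelevant t t')

  leastRepresentative : ∀ x → ∃ λ y → y ≈ x × (∀ z → z ≈ x → code y ≤ code z)
  leastRepresentative x with least em {λ n → ∃ λ y → y ≈ x × code y ≡ n} (code x) (x , ≈-refl x , refl)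
  ... | _ , (y , y≈x , refl) , minimal = y , y≈x , λ z z≈x → minimal (code z) (z , z≈x , refl)

  classOf : (x : Carrier) → ¬ Embedded x → Class
  classOf x x∉ =
    let y , y≈x , minimal = leastRepresentative x in
    code y , fromWitness (y , refl , (λ y∈ → x∉ (embedded-resp y≈x y∈)) , λ z z≈y → minimal z (≈-trans z≈y y≈x))

  rep-classOf : ∀ x x∉ → rep (classOf x x∉) ≈ x
  rep-classOf x x∉ = ≈-trans (code-injective (code-rep (classOf x x∉))) (proj₁ (proj₂ (leastRepresentative x)))

  H : Graph
  H = record
    { Carrier = Class
    ; Adj     = λ c c' → Adj (rep c) (rep c')
    ; Adj-sym = Adj-sym
    ; vertex  = classOf outsider λ (v , _ , outsider≈v) → outsider-∉ v outsider≈v }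

  private
    module G⊔H = Struct (G ⊔ H)

  toDec : (x : Carrier) → Dec (Embedded x) → G⊔H.Carrier
  toDec x (yes (v , Vv , _)) = inj₁ (v , Vv)
  toDec x (no x∉)            = inj₂ (classOf x x∉)

  from : G⊔H.Carrier → Carrier
  from (inj₁ (v , _)) = embed v
  from (inj₂ c)       = rep c

  toDec-cong : ∀ x y dx dy → x ≈ y → toDec x dx G⊔H.≈ toDec y dy
  toDec-cong x y (yes (v , _ , x≈v)) (yes (u , _ , y≈u)) x≈y = embed-injective (≈-trans (≈-sym x≈v) (≈-trans x≈y y≈u))
  toDec-cong x y (yes x∈) (no y∉) x≈y = y∉ (embedded-resp x≈y x∈)
  toDec-cong x y (no x∉) (yes y∈) x≈y = x∉ (embedded-resp (≈-sym x≈y) y∈)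
  toDec-cong x y (no x∉) (no y∉) x≈y =
    class-≡ _ _ (≈-trans (rep-classOf x x∉) (≈-trans x≈y (≈-sym (rep-classOf y y∉))))

  from-cong : ∀ {a b} → a G⊔H.≈ b → from a ≈ from b
  from-cong {inj₁ (v , _)} {inj₁ _} refl = ≈-refl (embed v)
  from-cong {inj₂ c}       {inj₂ _} refl = ≈-refl (rep c)

  from-toDec : ∀ x dx → from (toDec x dx) ≈ x
  from-toDec x (yes (_ , _ , x≈v)) = ≈-sym x≈v
  from-toDec x (no x∉)             = rep-classOf x x∉

  toDec-from : ∀ a d → toDec (from a) d G⊔H.≈ a
  toDec-from (inj₁ (v , _))  (yes (u , _ , v≈u)) = sym (embed-injective v≈u)
  toDec-from (inj₁ (v , Vv)) (no v∉)             = v∉ (v , Vv , ≈-refl (embed v))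
  toDec-from (inj₂ c)        (yes c∈)            = rep-∉ c c∈
  toDec-from (inj₂ c)        (no c∉)             = class-≡ _ c (rep-classOf (rep c) c∉)

  Adj-toDec : ∀ x y dx dy → Adj x y → G⊔H.Adj (toDec x dx) (toDec y dy)
  Adj-toDec x y (yes (v , _ , x≈v)) (yes (u , _ , y≈u)) xy = embed-Adj⁻ (Adj-resp x≈v y≈u xy)
  Adj-toDec x y (yes (v , Vv , x≈v)) (no y∉) xy = y∉ (embed-closed Vv (Adj-resp x≈v (≈-refl y) xy))
  Adj-toDec x y (no x∉) (yes (u , Vu , y≈u)) xy = x∉ (embed-closed Vu (Adj-resp y≈u (≈-refl x) (Adj-sym xy)))
  Adj-toDec x y (no x∉) (no y∉) xy = Adj-resp (≈-sym (rep-classOf x x∉)) (≈-sym (rep-classOf y y∉)) xy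

  Adj-fromDec : ∀ x y dx dy → G⊔H.Adj (toDec x dx) (toDec y dy) → Adj x y
  Adj-fromDec x y (yes (_ , _ , x≈v)) (yes (_ , _ , y≈u)) e = Adj-resp (≈-sym x≈v) (≈-sym y≈u) (embed-Adj e)
  Adj-fromDec x y (no x∉) (no y∉) cc' = Adj-resp (rep-classOf x x∉) (rep-classOf y y∉) cc'

  iso : Iso P (G ⊔ H)
  iso = record
    { to        = λ x → toDec x em
    ; from      = from
    ; to-cong   = λ {x} {y} → toDec-cong x y em em
    ; from-cong = from-cong
    ; from-to   = λ x → from-toDec x em
    ; to-from   = λ a → toDec-from a em
    ; Adj-to    = λ x y → Adj-toDec x y em em
    ; Adj-from  = λ x y → Adj-fromDec x y em em }

module _ (C : ℕ → Set) (A : CGraph) where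
  open Struct (CohesivePower C A)
  open CGraph A using (E-sym)

  cohesivePower-isGraphSetoid : IsGraphSetoid (CohesivePower C A)
  cohesivePower-isGraphSetoid = record
    { ≈-refl   = λ (_ , C⊆*dom , _) → ⊆*-mono (λ i (y , ↓y) → y , ↓y , ↓y) C⊆*dom
    ; ≈-sym    = ⊆*-mono λ i (y , ↓₁ , ↓₂) → y , ↓₂ , ↓₁
    ; ≈-trans  = λ {_} {_} {z} x≈y y≈z → ⊆*-mono (λ i ((a , x↓ , y↓a) , (b , y↓b , z↓)) →
                   a , x↓ , subst (proj₁ z ⟪ i ⟫↓_) (↓-functional y↓b y↓a) z↓) (⊆*-∩ x≈y y≈z)
    ; Adj-sym  = ⊆*-mono λ i (a , b , x↓ , y↓ , Eab) → b , a , y↓ , x↓ , E-sym Eab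
    ; Adj-resp = λ {_} {x'} {_} {y'} x≈x' y≈y' Axy → ⊆*-mono
                   (λ i ((a , b , x↓a , y↓b , Eab) , (a' , x↓a' , x'↓) , (b' , y↓b' , y'↓)) →
                     a , b , subst (proj₁ x' ⟪ i ⟫↓_) (↓-functional x↓a' x↓a) x'↓ ,
                             subst (proj₁ y' ⟪ i ⟫↓_) (↓-functional y↓b' y↓b) y'↓ , Eab)
                   (⊆*-∩ Axy (⊆*-∩ x≈x' y≈y')) }

  cohesivePower-encode-injective : ∀ {x y : Carrier} → encode (proj₁ x) ≡ encode (proj₁ y) → x ≈ y
  cohesivePower-encode-injective {x} eq =
    subst (λ φ → C ⊆* (λ i → ∃ λ a → proj₁ x ⟪ i ⟫↓ a × φ ⟪ i ⟫↓ a)) (encode-injective eq)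
          (IsGraphSetoid.≈-refl cohesivePower-isGraphSetoid x)

BlockAdj : (ℕ → ℕ → Set) → ℕ → ℕ → Set
BlockAdj E x y = block x ≡ block y × E (offset x) (offset y)

blockAdjᶜ : PR 2 → PR 2
blockAdjᶜ e = e ∘⟪ offsetᶜ ∘⟨ π₀ ⟩ , offsetᶜ ∘⟨ π₁ ⟩ ⟫ ∸ᶜ distᶜ ∘⟪ blockᶜ ∘⟨ π₀ ⟩ , blockᶜ ∘⟨ π₁ ⟩ ⟫

blockAdjᶜ↓ : ∀ {e x y r} → e ⟨ offset x ∷ offset y ∷ [] ⟩↓ r →
             blockAdjᶜ e ⟨ x ∷ y ∷ [] ⟩↓ (r ∸ ∣ block x - block y ∣)
blockAdjᶜ↓ {x = x} {y} e↓ = ∘₂↓ blocks-dist↓ (∘₂↓ offset₀↓ offset₁↓ e↓) (monusᶜ-computes _)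
  where
  xs : Vec ℕ 2
  xs = x ∷ y ∷ []
  offset₀↓ : offsetᶜ ∘⟨ π₀ ⟩ ⟨ xs ⟩↓ offset x
  offset₀↓ = ∘₁-computes offsetᶜ-computes proj₀-computes xs
  offset₁↓ : offsetᶜ ∘⟨ π₁ ⟩ ⟨ xs ⟩↓ offset y
  offset₁↓ = ∘₁-computes offsetᶜ-computes proj₁-computes xs
  blocks-dist↓ : distᶜ ∘⟪ blockᶜ ∘⟨ π₀ ⟩ , blockᶜ ∘⟨ π₁ ⟩ ⟫ ⟨ xs ⟩↓ ∣ block x - block y ∣
  blocks-dist↓ = ∘₂-computes distᶜ-computes (∘₁-computes blockᶜ-computes proj₀-computes)
                                            (∘₁-computes blockᶜ-computes proj₁-computes) xs

blockAdj-computable : ∀ {E} → ComputableRel E → ComputableRel (BlockAdj E)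
blockAdj-computable {E} (e , decides) = blockAdjᶜ e , decide
  where
  decide : ∀ x y → (BlockAdj E x y × blockAdjᶜ e ⟨ x ∷ y ∷ [] ⟩↓ 1)
                  ⊎ (¬ BlockAdj E x y × blockAdjᶜ e ⟨ x ∷ y ∷ [] ⟩↓ 0)
  decide x y with decides (offset x) (offset y) | block x ≟ block y
  ... | inj₁ (Exy , e↓1) | yes same = inj₁ ((same , Exy) ,
          subst (blockAdjᶜ e ⟨ x ∷ y ∷ [] ⟩↓_) (cong (1 ∸_) (m≡n⇒∣m-n∣≡0 same)) (blockAdjᶜ↓ e↓1))
  ... | inj₁ (_ , e↓1)   | no differ = inj₂ ((λ (same , _) → differ same) ,
          subst (blockAdjᶜ e ⟨ x ∷ y ∷ [] ⟩↓_) (m≤n⇒m∸n≡0 (n≢0⇒n>0 (differ ∘ ∣m-n∣≡0⇒m≡n))) (blockAdjᶜ↓ e↓1))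
  ... | inj₂ (¬Exy , e↓0) | _      = inj₂ ((λ (_ , Exy) → ¬Exy Exy) ,
          subst (blockAdjᶜ e ⟨ x ∷ y ∷ [] ⟩↓_) (0∸n≡0 ∣ block x - block y ∣) (blockAdjᶜ↓ e↓0))

-- In every block the numbers outside V are isolated vertices.
blockGraph : CGraph → CGraph
blockGraph G = record
  { V      = λ _ → ⊤
  ; E      = BlockAdj E
  ; E⊆V×V  = λ _ → tt , tt
  ; E-sym  = λ {x} {y} (same , Exy) → sym same , E-sym Exy
  ; vertex = 0 , tt
  ; V-comp = constᶜ 1 , λ x → inj₁ (tt , constᶜ-computes 1 (x ∷ []))
  ; E-comp = blockAdj-computable E-comp }
  where open CGraph G

star-block : ∀ {E x y} → Star (BlockAdj E) x y → block y ≡ block x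
star-block     ε                   = refl
star-block {E} ((same , _) ◅ path) = trans (star-block {E} path) (sym same)

blockGraph-stronglyLocallyFinite : ∀ G → StronglyLocallyFinite (blockGraph G)
blockGraph-stronglyLocallyFinite G x _ = tri (suc (block x)) , λ y (_ , path) →
  subst (_< tri (suc (block x))) (sym (tri-block+offset y))
        (subst (λ n → tri (block y) + offset y < tri (suc n)) (star-block {CGraph.E G} path)
               (tri+<tri-suc (offset≤block y)))

ψ : ℕ → PR 1
ψ v = triᶜ +ᶜ constᶜ v

ψ↓ : ∀ v i → ψ v ⟪ i ⟫↓ (tri i + v)
ψ↓ v i = +ᶜ-computes triᶜ-computes (constᶜ-computes v) (i ∷ [])

ψ↓-block-offset : ∀ {v i y} → v ≤ i → ψ v ⟪ i ⟫↓ y → block y ≡ i × offset y ≡ v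
ψ↓-block-offset {v} {i} v≤i ψ↓y rewrite ↓-functional ψ↓y (ψ↓ v i) = block-tri+ v≤i , offset-tri+ v≤i

module BlockEmbedding (em : ExcludedMiddle 0ℓ) (G : CGraph) (G-locallyFinite : LocallyFinite G)
                      (C : ℕ → Set) (C-cohesive : Cohesive C) where
  open CGraph G
  open Struct (CohesivePower C (blockGraph G))

  witness : ∀ {P : ℕ → Set} → C ⊆* P → ∀ m → ∃ λ i → m ≤ i × C i × P i
  witness = ⊆*-witness em (proj₁ C-cohesive)

  embed : ℕ → Carrier
  embed v = ψ v , ⊆*-cofinite 0 (λ i _ → tri i + v , ψ↓ v i) , λ _ _ _ → tt

  embed-injective : ∀ {v u} → embed v ≈ embed u → v ≡ u
  embed-injective {v} {u} v≈u with witness v≈u 0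
  ... | i , _ , _ , y , ψv↓y , ψu↓y =
    +-cancelˡ-≡ (tri i) v u (trans (↓-functional (ψ↓ v i) ψv↓y) (↓-functional ψu↓y (ψ↓ u i)))

  embed-Adj : ∀ {v u} → E v u → Adj (embed v) (embed u)
  embed-Adj {v} {u} Evu = ⊆*-cofinite (v + u) λ i v+u≤i →
    let v≤i = ≤-trans (m≤m+n v u) v+u≤i
        u≤i = ≤-trans (m≤n+m u v) v+u≤i
    in tri i + v , tri i + u , ψ↓ v i , ψ↓ u i , trans (block-tri+ v≤i) (sym (block-tri+ u≤i)) ,
       subst₂ E (sym (offset-tri+ v≤i)) (sym (offset-tri+ u≤i)) Evu

  embed-Adj⁻ : ∀ {v u} → Adj (embed v) (embed u) → E v u
  embed-Adj⁻ {v} {u} adj with witness adj (v + u)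
  ... | i , v+u≤i , _ , y , z , ψv↓y , ψu↓z , _ , Eyz =
    subst₂ E (proj₂ (ψ↓-block-offset (≤-trans (m≤m+n v u) v+u≤i) ψv↓y))
             (proj₂ (ψ↓-block-offset (≤-trans (m≤n+m u v) v+u≤i) ψu↓z)) Eyz

  AdjAt : PR 1 → PR 1 → ℕ → Set
  AdjAt φ χ i = ∃₂ λ y z → φ ⟪ i ⟫↓ y × χ ⟪ i ⟫↓ z × BlockAdj E y z

  ψ-neighbour : ∀ {v i y z} → v ≤ i → ψ v ⟪ i ⟫↓ y → BlockAdj E y z → z ≡ tri i + offset z × E v (offset z)
  ψ-neighbour {z = z} v≤i ψ↓y (same , Eyz) with ψ↓-block-offset v≤i ψ↓y
  ... | refl , refl = trans (tri-block+offset z) (cong (λ n → tri n + offset z) (sym same)) , Eyz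

  agreement-neighbour : ∀ {v x u} → C ⊆* Dom (agreeᶜ (proj₁ x) (ψ u)) → Adj (embed v) x → E v u
  agreement-neighbour {v} {x} {u} agree adj = at (witness (⊆*-∩ agree adj) (v + u))
    where
    at : (∃ λ i → v + u ≤ i × C i × Dom (agreeᶜ (proj₁ x) (ψ u)) i × AdjAt (ψ v) (proj₁ x) i) → E v u
    at (i , v+u≤i , _ , agree-i , y , z , ψv↓y , x↓z , yz) =
      subst (E v) offset-z≡u (proj₂ (ψ-neighbour {z = z} (≤-trans (m≤m+n v u) v+u≤i) ψv↓y yz))
      where
      common : ∃ λ a → proj₁ x ⟪ i ⟫↓ a × ψ u ⟪ i ⟫↓ a
      common = Dom⇒agree {proj₁ x} {ψ u} agree-i
      offset-z≡u : offset z ≡ u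
      offset-z≡u = trans (cong offset (trans (↓-functional x↓z (proj₁ (proj₂ common)))
                                             (↓-functional (proj₂ (proj₂ common)) (ψ↓ u i))))
                         (offset-tri+ (≤-trans (m≤n+m u v) v+u≤i))

  disagreement-isolated : ∀ {v x b} → (∀ u → V u × E v u → u < b) →
    C ⊆* (λ i → ∀ u → u < b → ¬ Dom (agreeᶜ (proj₁ x) (ψ u)) i) → ¬ Adj (embed v) x
  disagreement-isolated {v} {x} {b} neighbour<b disagree adj = at (witness (⊆*-∩ disagree adj) v)
    where
    at : ¬ (∃ λ i → v ≤ i × C i × (∀ u → u < b → ¬ Dom (agreeᶜ (proj₁ x) (ψ u)) i) × AdjAt (ψ v) (proj₁ x) i)
    at (i , v≤i , _ , disagree-i , y , z , ψv↓y , x↓z , yz) =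
      disagree-i (offset z) (neighbour<b (offset z) (proj₂ (E⊆V×V Ev-offset-z) , Ev-offset-z))
                 (agree⇒Dom (subst (proj₁ x ⟪ i ⟫↓_) z≡ x↓z) (ψ↓ (offset z) i))
      where
      z≡ : z ≡ tri i + offset z
      z≡ = proj₁ (ψ-neighbour {z = z} v≤i ψv↓y yz)
      Ev-offset-z : E v (offset z)
      Ev-offset-z = proj₂ (ψ-neighbour {z = z} v≤i ψv↓y yz)

  embed-closed : ∀ {v x} → V v → Adj (embed v) x → ∃ λ u → V u × x ≈ embed u
  embed-closed {v} {x} Vv adj = closed (G-locallyFinite v Vv)
    where
    closed : Finite (λ u → V u × E v u) → ∃ λ u → V u × x ≈ embed u
    closed (b , neighbour<b) with cohesive-split-family C-cohesive (λ u → agreeᶜ (proj₁ x) (ψ u)) b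
    ... | inj₁ (u , _ , agree) =
      u , proj₂ (E⊆V×V (agreement-neighbour {v} {x} {u} agree adj)) , ⊆*-mono (λ i → Dom⇒agree) agree
    ... | inj₂ disagree = ⊥-elim (disagreement-isolated {v} {x} {b} neighbour<b disagree adj)

  outsider : Carrier
  outsider = zeroF , ⊆*-cofinite 0 (λ i _ → 0 , zeroF-computes (i ∷ [])) , λ _ _ _ → tt

  outsider-∉ : ∀ v → ¬ outsider ≈ embed v
  outsider-∉ v 0≈v with witness 0≈v 1
  ... | i , 1≤i , _ , y , 0↓y , ψv↓y =
    <⇒≢ (≤-trans (tri-mono 1≤i) (m≤m+n (tri i) v))
        (trans (↓-functional (zeroF-computes (i ∷ [])) 0↓y) (↓-functional ψv↓y (ψ↓ v i)))

  embedding : ComponentEmbedding G (CohesivePower C (blockGraph G))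
  embedding = record
    { embed           = embed
    ; embed-injective = embed-injective
    ; embed-Adj       = embed-Adj
    ; embed-Adj⁻      = λ {v} {u} → embed-Adj⁻ {v} {u}
    ; embed-closed    = λ {v} {x} → embed-closed {v} {x}
    ; outsider        = outsider
    ; outsider-∉      = outsider-∉ }

mainTheorem2 : ExcludedMiddle 0ℓ →
    (G : CGraph) → Infinite (CGraph.V G) → LocallyFinite G →
    (C : ℕ → Set) → Cohesive C →
    Σ CGraph λ A → StronglyLocallyFinite A ×
    Σ Graph λ H → Iso (CohesivePower C A) (G ⊔ H)
mainTheorem2 em G _ G-locallyFinite C C-cohesive =
  blockGraph G , blockGraph-stronglyLocallyFinite G , H , iso
  where
  open Splitting em (cohesivePower-isGraphSetoid C (blockGraph G)) (encode ∘ proj₁)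
                 (λ {x} {y} → cohesivePower-encode-injective C (blockGraph G) {x} {y})
                 (BlockEmbedding.embedding em G G-locallyFinite C C-cohesive)
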